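{- Let $n\ge 0$ and let $\frac{a}{b}$ and $\frac{c}{d}$ be consecutive terms of $SB_n$ (in lowest terms, positive denominators) with $9\mid bc-ad$. If $a\equiv c\pmod 9$ and $b\equiv d\pmod 9$, then $\gcd(2a+c,2b+d)=\gcd(a+2c,b+2d)=3$ (both new mediants are reduced by a factor of $3$). If $a+c\equiv 0\pmod 9$ and $b+d\equiv 0\pmod 9$, then $\gcd(2a+c,2b+d)=\gcd(a+2c,b+2d)=1$ (no reduction).
   Context: The unit weight-$3$ Stern–Brocot sequences $SB_n$ ($n\ge0$): $SB_0=(\frac{0}{1},\frac{1}{1})$, and $SB_{n+1}$ is obtained from $SB_n$ by keeping all its terms in order and inserting, between each pair of consecutive terms $\frac{p}{q},\frac{r}{s}$ (in lowest terms, positive denominators), the two fractions $\frac{2p+r}{2q+s}$ and $\frac{p+2r}{q+2s}$, each reduced to lowest terms, in this order. All terms are written in lowest terms with positive denominator. -}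

module Defs where

open import Data.Nat using (ℕ; zero; suc; _+_; _*_; _/_)
open import Data.Nat.GCD using (gcd)
open import Data.Product using (_×_; _,_; ∃; ∃-syntax)
open import Data.List using (List; []; _∷_; _++_)
open import Relation.Binary.PropositionalEquality using (_≡_)

-- A fraction p/q is represented by the pair (p , q) : numerator, denominator.
Frac : Set
Frac = ℕ × ℕ

-- Reduce to lowest terms (divide both by their gcd; gcd 0 0 = 0 left as is,
-- which never occurs since denominators are positive).
reduce : Frac → Frac
reduce (p , q) with gcd p q
... | zero  = (p , q)
... | suc g = (p / suc g , q / suc g)

med₁ : Frac → Frac → Frac
med₁ (p , q) (r , s) = reduce (2 * p + r , 2 * q + s)

med₂ : Frac → Frac → Frac
med₂ (p , q) (r , s) = reduce (p + 2 * r , q + 2 * s)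

step : List Frac → List Frac
step []            = []
step (x ∷ [])      = x ∷ []
step (x ∷ y ∷ rest) = x ∷ med₁ x y ∷ med₂ x y ∷ step (y ∷ rest)

SB : ℕ → List Frac
SB zero    = (0 , 1) ∷ (1 , 1) ∷ []
SB (suc n) = step (SB n)

Consecutive : ℕ → Frac → Frac → Set
Consecutive n x y = ∃[ xs ] ∃[ ys ] SB n ≡ xs ++ x ∷ y ∷ ys

{-# OPTIONS --safe #-}
-- Call fractions p/q and r/s adjacent if both are reduced and the determinant
-- qr − ps divides a power of 3. The pair 0/1, 1/1 is adjacent, and inserting the
-- reduced mediants between adjacent terms creates determinants dividing D, 3D and D,
-- so consecutive terms of every SB n are adjacent. The gcd of an unreduced mediant
-- divides D, hence is a power of 3: it is 3 if 3 divides it but 9 does not, and 1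
-- if 3 does not divide it. If a ≡ c and b ≡ d (mod 9) then 2a + c ≡ 3a (mod 9), so
-- 3 divides the gcd; if a + c ≡ b + d ≡ 0 (mod 9) then 2a + c ≡ a (mod 9). In both
-- cases the excluded divisor (9, resp. 3) of the gcd would divide both a and b.
module Submission where

open import Defs
open import Data.Nat using (ℕ; zero; suc; _+_; _*_; _%_; _/_; _^_; NonZero)
open import Data.Nat.GCD using (gcd; gcd[m,n]∣m; gcd[m,n]∣n; gcd-greatest; gcd[m,n]≡0⇒m≡0; gcd[m,n]≡0⇒n≡0)
open import Data.Nat.Divisibility
open import Data.Nat.DivMod using (m≡m%n+[m/n]*n; m*[n/m]≡n)
open import Data.Nat.Coprimality using (Coprime; coprime-/gcd; coprime-divisor; 1-coprimeTo; 0-coprimeTo-m⇒m≡1)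
import Data.Nat.Coprimality as Coprime
open import Data.Nat.Primality using (Prime; prime?; prime⇒irreducible; prime⇒nonZero; ¬prime[1])
open import Data.Nat.Properties using (*-cancelˡ-≡; *-comm; *-identityˡ; *-distribˡ-+; *-assoc; +-comm; m+n≡0⇒m≡0; m+n≡0⇒n≡0; *-commutativeSemigroup)
open import Algebra.Properties.CommutativeSemigroup *-commutativeSemigroup using (x∙yz≈y∙xz)
open import Data.Nat.Tactic.RingSolver using (solve-∀)
open import Data.Integer using (+_; _-_)
open import Data.Integer.Divisibility as ℤDiv using ()
open import Data.Product using (_×_; _,_; ∃-syntax)
open import Data.Sum using (inj₁; inj₂)
open import Data.List using ([]; _∷_; _++_)
open import Data.List.Relation.Unary.Linked as Linked using (Linked; []; [-]; _∷_)
open import Function using (_∘_)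
open import Relation.Nullary using (contradiction)
open import Relation.Nullary.Decidable using (from-yes)
open import Relation.Binary.PropositionalEquality
  using (_≡_; _≢_; refl; sym; trans; cong; cong₂; subst; subst₂; module ≡-Reasoning)

open ≡-Reasoning

infix 4 _∣_^∞

_∣_^∞ : ℕ → ℕ → Set
d ∣ p ^∞ = ∃[ k ] d ∣ p ^ k

∣-∣^∞ : ∀ {m n p} → m ∣ n → n ∣ p ^∞ → m ∣ p ^∞
∣-∣^∞ m∣n (k , n∣pᵏ) = k , ∣-trans m∣n n∣pᵏ

*-∣^∞ : ∀ {n p} → n ∣ p ^∞ → p * n ∣ p ^∞
*-∣^∞ {p = p} (k , n∣pᵏ) = suc k , *-monoʳ-∣ p n∣pᵏ

∤⇒coprime : ∀ {p d} → Prime p → p ∤ d → Coprime d p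
∤⇒coprime pp p∤d (e∣d , e∣p) with prime⇒irreducible pp e∣p
... | inj₁ e≡1  = e≡1
... | inj₂ refl = contradiction e∣d p∤d

∣p^∞∧p∤⇒≡1 : ∀ {p d} → Prime p → d ∣ p ^∞ → p ∤ d → d ≡ 1
∣p^∞∧p∤⇒≡1 {p} {d} pp (k , d∣pᵏ) p∤d = go k d∣pᵏ
  where
  go : ∀ k → d ∣ p ^ k → d ≡ 1
  go zero    d∣1    = ∣1⇒≡1 d∣1
  go (suc k) d∣pᵏ⁺¹ = go k (coprime-divisor (∤⇒coprime pp p∤d) d∣pᵏ⁺¹)

∣p^∞∧p∣∧p²∤⇒≡p : ∀ {p d} → Prime p → d ∣ p ^∞ → p ∣ d → p * p ∤ d → d ≡ p
∣p^∞∧p∣∧p²∤⇒≡p {p} pp (k , hp∣pᵏ) (divides h refl) p²∤hp = trans (cong (_* p) (h≡1 k hp∣pᵏ)) (*-identityˡ p)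
  where
  instance _ = prime⇒nonZero pp
  p∤h : p ∤ h
  p∤h (divides j refl) = p²∤hp (divides j (*-assoc j p p))
  h≡1 : ∀ k → h * p ∣ p ^ k → h ≡ 1
  h≡1 zero    hp∣1   = contradiction (subst Prime (∣1⇒≡1 (∣-trans (n∣m*n h) hp∣1)) pp) ¬prime[1]
  h≡1 (suc k) hp∣pᵏ⁺¹ =
    ∣p^∞∧p∤⇒≡1 pp (k , *-cancelˡ-∣ p (subst (_∣ p ^ suc k) (*-comm h p) hp∣pᵏ⁺¹)) p∤h

3∣9 : 3 ∣ 9
3∣9 = divides 3 refl

%9≡⇒2m+n≡9k+3[m%9] : ∀ m n → m % 9 ≡ n % 9 → 2 * m + n ≡ 9 * (2 * (m / 9) + n / 9) + 3 * (m % 9)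
%9≡⇒2m+n≡9k+3[m%9] m n m≡n = begin
  2 * m + n
    ≡⟨ cong₂ (λ u v → 2 * u + v) (m≡m%n+[m/n]*n m 9) n≡m%9+[n/9]*9 ⟩
  2 * (m % 9 + m / 9 * 9) + (m % 9 + n / 9 * 9)
    ≡⟨ regroup (m % 9) (m / 9) (n / 9) ⟩
  9 * (2 * (m / 9) + n / 9) + 3 * (m % 9) ∎
  where
  n≡m%9+[n/9]*9 : n ≡ m % 9 + n / 9 * 9
  n≡m%9+[n/9]*9 = trans (m≡m%n+[m/n]*n n 9) (cong (_+ n / 9 * 9) (sym m≡n))
  regroup : ∀ r x y → 2 * (r + x * 9) + (r + y * 9) ≡ 9 * (2 * x + y) + 3 * r
  regroup = solve-∀

%9≡⇒3∣2m+n : ∀ m n → m % 9 ≡ n % 9 → 3 ∣ 2 * m + n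
%9≡⇒3∣2m+n m n m≡n = subst (3 ∣_) (sym (%9≡⇒2m+n≡9k+3[m%9] m n m≡n))
  (∣m∣n⇒∣m+n (∣-trans 3∣9 (m∣m*n (2 * (m / 9) + n / 9))) (m∣m*n (m % 9)))

%9≡∧9∣2m+n⇒3∣m : ∀ m n → m % 9 ≡ n % 9 → 9 ∣ 2 * m + n → 3 ∣ m
%9≡∧9∣2m+n⇒3∣m m n m≡n 9∣2m+n = subst (3 ∣_) (sym (m≡m%n+[m/n]*n m 9))
  (∣m∣n⇒∣m+n 3∣m%9 (∣-trans 3∣9 (n∣m*n (m / 9))))
  where
  3∣m%9 : 3 ∣ m % 9
  3∣m%9 = *-cancelˡ-∣ 3 (∣m+n∣m⇒∣n (subst (9 ∣_) (%9≡⇒2m+n≡9k+3[m%9] m n m≡n) 9∣2m+n)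
                                   (m∣m*n (2 * (m / 9) + n / 9)))

9∣m+n∧3∣2m+n⇒3∣m : ∀ {m n} → 9 ∣ m + n → 3 ∣ 2 * m + n → 3 ∣ m
9∣m+n∧3∣2m+n⇒3∣m {m} {n} 9∣m+n 3∣2m+n =
  ∣m+n∣m⇒∣n (subst (3 ∣_) (2m+n≡[m+n]+m m n) 3∣2m+n) (∣-trans 3∣9 9∣m+n)
  where
  2m+n≡[m+n]+m : ∀ m n → 2 * m + n ≡ (m + n) + m
  2m+n≡[m+n]+m = solve-∀

Reduced : Frac → Set
Reduced (p , q) = Coprime p q

gcdᶠ : Frac → ℕ
gcdᶠ (p , q) = gcd p q

infixr 7 _·ᶠ_

_·ᶠ_ : ℕ → Frac → Frac
g ·ᶠ (p , q) = g * p , g * q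

lin₁ lin₂ : Frac → Frac → Frac
lin₁ (p , q) (r , s) = 2 * p + r , 2 * q + s
lin₂ (p , q) (r , s) = p + 2 * r , q + 2 * s

-- The determinant qr − ps of p/q and r/s, stated additively to avoid truncated subtraction.
Det : Frac → Frac → ℕ → Set
Det (p , q) (r , s) D = q * r ≡ p * s + D

reduce-spec : ∀ x → gcdᶠ x ≢ 0 → ∃[ h ] x ≡ suc h ·ᶠ reduce x × Reduced (reduce x)
reduce-spec (p , q) gcd≢0 with gcd p q in gcd≡
... | zero  = contradiction refl gcd≢0
... | suc h = h , cong₂ _,_ (sym (m*[n/m]≡n (subst (_∣ p) gcd≡ (gcd[m,n]∣m p q))))
                            (sym (m*[n/m]≡n (subst (_∣ q) gcd≡ (gcd[m,n]∣n p q))))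
                , subst (λ g → .{{_ : NonZero g}} → Coprime (p / g) (q / g)) gcd≡ (coprime-/gcd p q)

lin₂≡lin₁-swap : ∀ x y → lin₂ x y ≡ lin₁ y x
lin₂≡lin₁-swap (p , q) (r , s) = cong₂ _,_ (+-comm p (2 * r)) (+-comm q (2 * s))

gcd-lin₁≢0 : ∀ x y → Reduced x → gcdᶠ (lin₁ x y) ≢ 0
gcd-lin₁≢0 (p , q) (r , s) cp gcd≡0 = contradiction (0-coprimeTo-m⇒m≡1 coprime[0,0]) λ ()
  where
  2m+n≡0⇒m≡0 : ∀ {m n} → 2 * m + n ≡ 0 → m ≡ 0
  2m+n≡0⇒m≡0 {m} e = m+n≡0⇒m≡0 m (m+n≡0⇒m≡0 (2 * m) e)
  coprime[0,0] : Coprime 0 0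
  coprime[0,0] = subst₂ Coprime (2m+n≡0⇒m≡0 (gcd[m,n]≡0⇒m≡0 gcd≡0))
                                (2m+n≡0⇒m≡0 (gcd[m,n]≡0⇒n≡0 (2 * p + r) gcd≡0)) cp

gcd-lin₂≢0 : ∀ x y → Reduced y → gcdᶠ (lin₂ x y) ≢ 0
gcd-lin₂≢0 x y ry = subst (λ z → gcdᶠ z ≢ 0) (sym (lin₂≡lin₁-swap x y)) (gcd-lin₁≢0 y x ry)

det-lin₁ : ∀ x y {D} → Det x y D → Det x (lin₁ x y) D
det-lin₁ (p , q) (r , s) {D} qr≡ps+D = begin
  q * (2 * p + r)         ≡⟨ expand p q r ⟩
  2 * p * q + q * r       ≡⟨ cong (λ t → 2 * p * q + t) qr≡ps+D ⟩
  2 * p * q + (p * s + D) ≡⟨ collect p q s D ⟩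
  p * (2 * q + s) + D     ∎
  where
  expand : ∀ p q r → q * (2 * p + r) ≡ 2 * p * q + q * r
  expand = solve-∀
  collect : ∀ p q s D → 2 * p * q + (p * s + D) ≡ p * (2 * q + s) + D
  collect = solve-∀

det-lin₂ : ∀ x y {D} → Det x y D → Det (lin₂ x y) y D
det-lin₂ (p , q) (r , s) {D} qr≡ps+D = begin
  (q + 2 * s) * r         ≡⟨ expand q r s ⟩
  q * r + 2 * r * s       ≡⟨ cong (λ t → t + 2 * r * s) qr≡ps+D ⟩
  p * s + D + 2 * r * s   ≡⟨ collect p r s D ⟩
  (p + 2 * r) * s + D     ∎
  where
  expand : ∀ q r s → (q + 2 * s) * r ≡ q * r + 2 * r * s
  expand = solve-∀
  collect : ∀ p r s D → p * s + D + 2 * r * s ≡ (p + 2 * r) * s + D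
  collect = solve-∀

-- Both sides are affine in qr, and the qr-coefficients 4 and 1 differ by 3.
det-lin₁-lin₂ : ∀ x y {D} → Det x y D → Det (lin₁ x y) (lin₂ x y) (3 * D)
det-lin₁-lin₂ (p , q) (r , s) {D} qr≡ps+D = begin
  (2 * q + s) * (p + 2 * r)               ≡⟨ expand p q r s ⟩
  A + 4 * (q * r)                         ≡⟨ cong (λ t → A + 4 * t) qr≡ps+D ⟩
  A + 4 * (p * s + D)                     ≡⟨ shift p q r s D ⟩
  A + 3 * (p * s) + 3 * D + (p * s + D)   ≡⟨ cong (λ t → A + 3 * (p * s) + 3 * D + t) qr≡ps+D ⟨
  A + 3 * (p * s) + 3 * D + q * r         ≡⟨ collect p q r s D ⟩
  (2 * p + r) * (q + 2 * s) + 3 * D       ∎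
  where
  A : ℕ
  A = 2 * p * q + p * s + 2 * r * s
  expand : ∀ p q r s → (2 * q + s) * (p + 2 * r) ≡ 2 * p * q + p * s + 2 * r * s + 4 * (q * r)
  expand = solve-∀
  shift : ∀ p q r s D → 2 * p * q + p * s + 2 * r * s + 4 * (p * s + D)
                      ≡ 2 * p * q + p * s + 2 * r * s + 3 * (p * s) + 3 * D + (p * s + D)
  shift = solve-∀
  collect : ∀ p q r s D → 2 * p * q + p * s + 2 * r * s + 3 * (p * s) + 3 * D + q * r
                        ≡ (2 * p + r) * (q + 2 * s) + 3 * D
  collect = solve-∀

gcdˡ∣det : ∀ x y {D} → Det x y D → gcdᶠ x ∣ D
gcdˡ∣det (p , q) (r , s) qr≡ps+D = ∣m+n∣m⇒∣n
  (subst (gcd p q ∣_) qr≡ps+D (∣-trans (gcd[m,n]∣n p q) (m∣m*n r)))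
  (∣-trans (gcd[m,n]∣m p q) (m∣m*n s))

gcdʳ∣det : ∀ x y {D} → Det x y D → gcdᶠ y ∣ D
gcdʳ∣det (p , q) (r , s) qr≡ps+D = ∣m+n∣m⇒∣n
  (subst (gcd r s ∣_) qr≡ps+D (∣-trans (gcd[m,n]∣m r s) (n∣m*n q)))
  (∣-trans (gcd[m,n]∣n r s) (n∣m*n p))

*-cancelˡ-+ : ∀ g {u v D} .{{_ : NonZero g}} → g * u ≡ g * v + D → ∃[ D′ ] D′ ∣ D × u ≡ v + D′
*-cancelˡ-+ g {u} {v} {D} gu≡gv+D = quotient g∣D , quotient-∣ g∣D ,
  *-cancelˡ-≡ u (v + quotient g∣D) g (begin
    g * u                    ≡⟨ gu≡gv+D ⟩
    g * v + D                ≡⟨ cong (λ t → g * v + t) (m∣n⇒n≡m*quotient g∣D) ⟩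
    g * v + g * quotient g∣D ≡⟨ *-distribˡ-+ g v (quotient g∣D) ⟨
    g * (v + quotient g∣D)   ∎)
  where
  g∣D : g ∣ D
  g∣D = ∣m+n∣m⇒∣n (subst (g ∣_) gu≡gv+D (m∣m*n u)) (m∣m*n v)

det-cancelˡ : ∀ g x y {D} .{{_ : NonZero g}} → Det (g ·ᶠ x) y D → ∃[ D′ ] D′ ∣ D × Det x y D′
det-cancelˡ g (p , q) (r , s) {D} det = *-cancelˡ-+ g
  (subst₂ (λ u v → u ≡ v + D) (*-assoc g q r) (*-assoc g p s) det)

det-cancelʳ : ∀ g x y {D} .{{_ : NonZero g}} → Det x (g ·ᶠ y) D → ∃[ D′ ] D′ ∣ D × Det x y D′
det-cancelʳ g (p , q) (r , s) {D} det = *-cancelˡ-+ g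
  (subst₂ (λ u v → u ≡ v + D) (x∙yz≈y∙xz q g r) (x∙yz≈y∙xz p g s) det)

Det∣3^∞ : Frac → Frac → Set
Det∣3^∞ x y = ∃[ D ] Det x y D × D ∣ 3 ^∞

Adjacent : Frac → Frac → Set
Adjacent x y = Reduced x × Reduced y × Det∣3^∞ x y

det∣3^∞-cancelˡ : ∀ g {x} z {y} .{{_ : NonZero g}} → x ≡ g ·ᶠ z → Det∣3^∞ x y → Det∣3^∞ z y
det∣3^∞-cancelˡ g z {y} refl (D , det , D∣3^∞) with det-cancelˡ g z y det
... | D′ , D′∣D , det′ = D′ , det′ , ∣-∣^∞ D′∣D D∣3^∞

det∣3^∞-cancelʳ : ∀ g {x y} z .{{_ : NonZero g}} → y ≡ g ·ᶠ z → Det∣3^∞ x y → Det∣3^∞ x z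
det∣3^∞-cancelʳ g {x} z refl (D , det , D∣3^∞) with det-cancelʳ g x z det
... | D′ , D′∣D , det′ = D′ , det′ , ∣-∣^∞ D′∣D D∣3^∞

gcd-lin₁∣3^∞ : ∀ x y → Det∣3^∞ x y → gcdᶠ (lin₁ x y) ∣ 3 ^∞
gcd-lin₁∣3^∞ x y (D , det , D∣3^∞) = ∣-∣^∞ (gcdʳ∣det x (lin₁ x y) (det-lin₁ x y det)) D∣3^∞

gcd-lin₁-swap∣3^∞ : ∀ x y → Det∣3^∞ x y → gcdᶠ (lin₁ y x) ∣ 3 ^∞
gcd-lin₁-swap∣3^∞ x y (D , det , D∣3^∞) = subst (λ z → gcdᶠ z ∣ 3 ^∞) (lin₂≡lin₁-swap x y)
  (∣-∣^∞ (gcdˡ∣det (lin₂ x y) y (det-lin₂ x y det)) D∣3^∞)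

mediants-adjacent : ∀ {x y} → Adjacent x y →
  Adjacent x (med₁ x y) × Adjacent (med₁ x y) (med₂ x y) × Adjacent (med₂ x y) y
mediants-adjacent {x@(_ , _)} {y@(_ , _)} (rx , ry , D , det , D∣3^∞)
  with reduce-spec (lin₁ x y) (gcd-lin₁≢0 x y rx) | reduce-spec (lin₂ x y) (gcd-lin₂≢0 x y ry)
... | h₁ , lin₁≡ , r₁ | h₂ , lin₂≡ , r₂ =
  (rx , r₁ , det∣3^∞-cancelʳ (suc h₁) {x} m₁ lin₁≡ (D , det-lin₁ x y det , D∣3^∞)) ,
  (r₁ , r₂ , det∣3^∞-cancelˡ (suc h₁) m₁ {m₂} lin₁≡ (det∣3^∞-cancelʳ (suc h₂) {lin₁ x y} m₂ lin₂≡
               (3 * D , det-lin₁-lin₂ x y det , *-∣^∞ D∣3^∞))) ,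
  (r₂ , ry , det∣3^∞-cancelˡ (suc h₂) m₂ {y} lin₂≡ (D , det-lin₂ x y det , D∣3^∞))
  where
  m₁ m₂ : Frac
  m₁ = med₁ x y
  m₂ = med₂ x y

step⁺ : ∀ {R : Frac → Frac → Set} →
  (∀ {x y} → R x y → R x (med₁ x y) × R (med₁ x y) (med₂ x y) × R (med₂ x y) y) →
  ∀ {xs} → Linked R xs → Linked R (step xs)
step⁺ R⇒ []           = []
step⁺ R⇒ [-]          = [-]
step⁺ R⇒ (Rxy ∷ [-]) =
  let Rxm₁ , Rm₁m₂ , Rm₂y = R⇒ Rxy in Rxm₁ ∷ Rm₁m₂ ∷ Rm₂y ∷ [-]
step⁺ R⇒ (Rxy ∷ Ryzs@(_ ∷ _)) =
  let Rxm₁ , Rm₁m₂ , Rm₂y = R⇒ Rxy in Rxm₁ ∷ Rm₁m₂ ∷ Rm₂y ∷ step⁺ R⇒ Ryzs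

Linked-++-∷∷⁻ : ∀ {A : Set} {R : A → A → Set} xs {x y ys} → Linked R (xs ++ x ∷ y ∷ ys) → R x y
Linked-++-∷∷⁻ []       = Linked.head
Linked-++-∷∷⁻ (_ ∷ xs) = Linked-++-∷∷⁻ xs ∘ Linked.tail

SB-adjacent : ∀ n → Linked Adjacent (SB n)
SB-adjacent zero    = (Coprime.sym (1-coprimeTo 0) , 1-coprimeTo 1 , 1 , refl , 0 , ∣-refl) ∷ [-]
SB-adjacent (suc n) = step⁺ mediants-adjacent (SB-adjacent n)

consecutive⇒adjacent : ∀ n {x y} → Consecutive n x y → Adjacent x y
consecutive⇒adjacent n (xs , ys , SBn≡) = Linked-++-∷∷⁻ xs (subst (Linked Adjacent) SBn≡ (SB-adjacent n))

prime[3] : Prime 3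
prime[3] = from-yes (prime? 3)

%9≡⇒gcd[2a+c,2b+d]≡3 : ∀ a b c d → Coprime a b → a % 9 ≡ c % 9 → b % 9 ≡ d % 9 →
  gcd (2 * a + c) (2 * b + d) ∣ 3 ^∞ → gcd (2 * a + c) (2 * b + d) ≡ 3
%9≡⇒gcd[2a+c,2b+d]≡3 a b c d cp a≡c b≡d G∣3^∞ = ∣p^∞∧p∣∧p²∤⇒≡p prime[3] G∣3^∞
  (gcd-greatest (%9≡⇒3∣2m+n a c a≡c) (%9≡⇒3∣2m+n b d b≡d))
  λ 9∣G → contradiction (cp (%9≡∧9∣2m+n⇒3∣m a c a≡c (∣-trans 9∣G G∣2a+c) ,
                             %9≡∧9∣2m+n⇒3∣m b d b≡d (∣-trans 9∣G G∣2b+d))) λ ()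
  where
  G∣2a+c : gcd (2 * a + c) (2 * b + d) ∣ 2 * a + c
  G∣2a+c = gcd[m,n]∣m (2 * a + c) (2 * b + d)
  G∣2b+d : gcd (2 * a + c) (2 * b + d) ∣ 2 * b + d
  G∣2b+d = gcd[m,n]∣n (2 * a + c) (2 * b + d)

9∣a+c⇒gcd[2a+c,2b+d]≡1 : ∀ a b c d → Coprime a b → 9 ∣ a + c → 9 ∣ b + d →
  gcd (2 * a + c) (2 * b + d) ∣ 3 ^∞ → gcd (2 * a + c) (2 * b + d) ≡ 1
9∣a+c⇒gcd[2a+c,2b+d]≡1 a b c d cp 9∣a+c 9∣b+d G∣3^∞ = ∣p^∞∧p∤⇒≡1 prime[3] G∣3^∞
  λ 3∣G → contradiction (cp (9∣m+n∧3∣2m+n⇒3∣m 9∣a+c (∣-trans 3∣G G∣2a+c) ,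
                             9∣m+n∧3∣2m+n⇒3∣m 9∣b+d (∣-trans 3∣G G∣2b+d))) λ ()
  where
  G∣2a+c : gcd (2 * a + c) (2 * b + d) ∣ 2 * a + c
  G∣2a+c = gcd[m,n]∣m (2 * a + c) (2 * b + d)
  G∣2b+d : gcd (2 * a + c) (2 * b + d) ∣ 2 * b + d
  G∣2b+d = gcd[m,n]∣n (2 * a + c) (2 * b + d)

corollary8 : (n a b c d : ℕ) → Consecutive n (a , b) (c , d) →
    ℤDiv._∣_ (+ 9) ((+ b) Data.Integer.* (+ c) - (+ a) Data.Integer.* (+ d)) →
    ((a % 9 ≡ c % 9 × b % 9 ≡ d % 9) →
      gcd (2 * a + c) (2 * b + d) ≡ 3 × gcd (a + 2 * c) (b + 2 * d) ≡ 3)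
    × ((9 ∣ a + c × 9 ∣ b + d) →
      gcd (2 * a + c) (2 * b + d) ≡ 1 × gcd (a + 2 * c) (b + 2 * d) ≡ 1)
corollary8 n a b c d consecutive _ with consecutive⇒adjacent n consecutive
... | ab-reduced , cd-reduced , det∣3^∞ = same-residues , opposite-residues
  where
  x y : Frac
  x = a , b
  y = c , d
  G₁∣3^∞ : gcdᶠ (lin₁ x y) ∣ 3 ^∞
  G₁∣3^∞ = gcd-lin₁∣3^∞ x y det∣3^∞
  G₂∣3^∞ : gcdᶠ (lin₁ y x) ∣ 3 ^∞
  G₂∣3^∞ = gcd-lin₁-swap∣3^∞ x y det∣3^∞
  G₂≡ : gcdᶠ (lin₂ x y) ≡ gcdᶠ (lin₁ y x)
  G₂≡ = cong gcdᶠ (lin₂≡lin₁-swap x y)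
  same-residues : (a % 9 ≡ c % 9 × b % 9 ≡ d % 9) → gcdᶠ (lin₁ x y) ≡ 3 × gcdᶠ (lin₂ x y) ≡ 3
  same-residues (a≡c , b≡d) =
    %9≡⇒gcd[2a+c,2b+d]≡3 a b c d ab-reduced a≡c b≡d G₁∣3^∞ ,
    trans G₂≡ (%9≡⇒gcd[2a+c,2b+d]≡3 c d a b cd-reduced (sym a≡c) (sym b≡d) G₂∣3^∞)
  opposite-residues : (9 ∣ a + c × 9 ∣ b + d) → gcdᶠ (lin₁ x y) ≡ 1 × gcdᶠ (lin₂ x y) ≡ 1
  opposite-residues (9∣a+c , 9∣b+d) =
    9∣a+c⇒gcd[2a+c,2b+d]≡1 a b c d ab-reduced 9∣a+c 9∣b+d G₁∣3^∞ ,
    trans G₂≡ (9∣a+c⇒gcd[2a+c,2b+d]≡1 c d a b cd-reduced (subst (9 ∣_) (+-comm a c) 9∣a+c)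
                                                  (subst (9 ∣_) (+-comm b d) 9∣b+d) G₂∣3^∞)
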